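{- Let $p\ge5$ be prime. For $r=1,2,3$, the Laurent series \[ F_r(q):=\Lambda_p\!\left(\frac{C(q)}{t(q)^{rp}}\right)-\frac{C(q)}{t(q)^r} \] satisfies $F_r(q)=O(q^{ -r+1})$, i.e. it has pole order at most $r-1$ at $q=0$.
   Context: $\chi_3(n)=\left(\frac{n}{3}\right)$; $C(q)=1+\sum_{n\ge1}c_nq^n$, $c_n=3\sum_{d\mid n}\chi_3(d)d^4$; $t(q)=q\prod_{n\ge1}(1-q^{3n})^{12}(1-q^n)^{ -12}$. For a Laurent series $f=\sum_{n\gg-\infty}a_nq^n$, $\Lambda_p(f):=\sum_na_{np}q^n$. -}

module Defs where

open import Data.Nat as ℕ using (ℕ; zero; suc; _∸_; _%_)
open import Data.Nat.Divisibility using (_∣?_)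
open import Data.Integer as ℤ using (ℤ; +_; -[1+_]; 0ℤ; 1ℤ)
open import Relation.Nullary using (yes; no)

PS : Set
PS = ℕ → ℤ

-- Laurent series with integer coefficients: coefficient function on ℤ.
-- (All Laurent series below are built as q^{-k} · g for a power series g,
-- so they are bounded below.)
Laur : Set
Laur = ℤ → ℤ

sumTo : (ℕ → ℤ) → ℕ → ℤ
sumTo f zero    = f zero
sumTo f (suc n) = sumTo f n ℤ.+ f (suc n)

sum1To : (ℕ → ℤ) → ℕ → ℤ
sum1To g zero    = 0ℤ
sum1To g (suc n) = sum1To g n ℤ.+ g (suc n)

onePS : PS
onePS zero    = 1ℤ
onePS (suc _) = 0ℤ

_⊛_ : PS → PS → PS
(a ⊛ b) n = sumTo (λ i → a i ℤ.* b (n ∸ i)) n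

powPS : PS → ℕ → PS
powPS a zero    = onePS
powPS a (suc k) = a ⊛ powPS a k

-- Reciprocal of a power series with constant term 1:
-- b 0 = 1, b n = - Σ_{k=1}^{n} a k * b (n-k).  (fuel-based structural recursion)
recipFuel : PS → ℕ → ℕ → ℤ
recipFuel a zero    n       = 1ℤ
recipFuel a (suc f) zero    = 1ℤ
recipFuel a (suc f) (suc n) =
  ℤ.- sum1To (λ k → a k ℤ.* recipFuel a f (suc n ∸ k)) (suc n)

recip : PS → PS
recip a n = recipFuel a (suc n) n

prodTo : (ℕ → PS) → ℕ → PS
prodTo f zero    = onePS
prodTo f (suc N) = prodTo f N ⊛ f (suc N)

oneMinusQ : ℕ → PS
oneMinusQ m zero = 1ℤ
oneMinusQ m (suc j) with m ℕ.≟ suc j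
... | yes _ = ℤ.- 1ℤ
... | no  _ = 0ℤ

-- (1 - q^m)^{-1} = Σ_k q^{mk}   (m ≥ 1)
geomQ : ℕ → PS
geomQ m j with m ∣? j
... | yes _ = 1ℤ
... | no  _ = 0ℤ

-- U(q) = ∏_{n≥1} (1-q^{3n})^{12} (1-q^n)^{-12}; the coefficient of q^N only
-- depends on the factors with n ≤ N, so it is read off the finite product.
U : PS
U N = prodTo (λ n → powPS (oneMinusQ (3 ℕ.* n)) 12 ⊛ powPS (geomQ n) 12) N N

χ₃ : ℕ → ℤ
χ₃ n with n % 3
... | 0 = 0ℤ
... | 1 = 1ℤ
... | _ = ℤ.- 1ℤ

cCoeff : ℕ → ℤ
cCoeff n = + 3 ℤ.* sum1To (λ d → term d) n
  where
  term : ℕ → ℤ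
  term d with d ∣? n
  ... | yes _ = χ₃ d ℤ.* (+ (d ℕ.^ 4))
  ... | no  _ = 0ℤ

C : PS
C zero    = 1ℤ
C (suc n) = cCoeff (suc n)

shiftLaur : ℕ → PS → Laur
shiftLaur k g n with n ℤ.+ + k
... | + m      = g m
... | -[1+ _ ] = 0ℤ

-- C(q) / t(q)^m = q^{-m} · C(q) · U(q)^{-m}
CdivT : ℕ → Laur
CdivT m = shiftLaur m (C ⊛ powPS (recip U) m)

Λ : ℕ → Laur → Laur
Λ p f n = f (n ℤ.* + p)

F : ℕ → ℕ → Laur
F p r n = Λ p (CdivT (r ℕ.* p)) n ℤ.- CdivT r n

{-# OPTIONS --safe #-}
module Submission where

-- C/t^m is q^(-m) times a power series with constant term 1.  Λ_p sends
-- q^(-rp)(1 + O(q)) to q^(-r)(1 + O(q)), so the two q^(-r) terms of F_r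
-- cancel and no lower powers occur.

open import Defs
open import Data.Nat as ℕ using (ℕ; zero; suc; _≤_; NonZero)
open import Data.Nat.Primality using (Prime)
open import Data.Integer as ℤ using (ℤ; +_; -[1+_]; 0ℤ; 1ℤ)
import Data.Integer.Properties as ℤ
open import Relation.Binary.PropositionalEquality using (_≡_; refl; sym; trans; cong; cong₂)
open Relation.Binary.PropositionalEquality.≡-Reasoning

fromPS : PS → Laur
fromPS g (+ m)    = g m
fromPS g -[1+ _ ] = 0ℤ

shiftLaur-fromPS : ∀ k g n → shiftLaur k g n ≡ fromPS g (n ℤ.+ + k)
shiftLaur-fromPS k g n with n ℤ.+ + k
... | + _      = refl
... | -[1+ _ ] = refl

Λ-shiftLaur : ∀ p k g n →
  Λ p (shiftLaur (k ℕ.* p) g) n ≡ fromPS g ((n ℤ.+ + k) ℤ.* + p)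
Λ-shiftLaur p k g n = begin
  shiftLaur (k ℕ.* p) g (n ℤ.* + p)          ≡⟨ shiftLaur-fromPS (k ℕ.* p) g (n ℤ.* + p) ⟩
  fromPS g (n ℤ.* + p ℤ.+ + (k ℕ.* p))       ≡⟨ cong (λ x → fromPS g (n ℤ.* + p ℤ.+ x)) (ℤ.pos-* k p) ⟩
  fromPS g (n ℤ.* + p ℤ.+ + k ℤ.* + p)       ≡⟨ cong (fromPS g) (sym (ℤ.*-distribʳ-+ (+ p) n (+ k))) ⟩
  fromPS g ((n ℤ.+ + k) ℤ.* + p)             ∎

fromPS-*-nonpos : ∀ p .{{_ : NonZero p}} g s → s ℤ.≤ 0ℤ →
  fromPS g (s ℤ.* + p) ≡ fromPS g s
fromPS-*-nonpos (suc _) g (+ zero)  _          = refl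
fromPS-*-nonpos (suc _) g (+ suc _) (ℤ.+≤+ ())
fromPS-*-nonpos (suc _) g -[1+ _ ]  _          = refl

fromPS-nonpos-head : ∀ g h s → g 0 ≡ h 0 → s ℤ.≤ 0ℤ → fromPS g s ≡ fromPS h s
fromPS-nonpos-head g h (+ zero)  g₀≡h₀ _          = g₀≡h₀
fromPS-nonpos-head g h (+ suc _) _     (ℤ.+≤+ ())
fromPS-nonpos-head g h -[1+ _ ]  _     _          = refl

powPS-head : ∀ a m → a 0 ≡ 1ℤ → powPS a m 0 ≡ 1ℤ
powPS-head a zero    _    = refl
powPS-head a (suc m) a₀≡1 = cong₂ ℤ._*_ a₀≡1 (powPS-head a m a₀≡1)

CdivU : ℕ → PS
CdivU m = C ⊛ powPS (recip U) m

CdivU-head : ∀ m → CdivU m 0 ≡ 1ℤ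
CdivU-head m = cong (1ℤ ℤ.*_) (powPS-head (recip U) m refl)

F-vanishes-below-pole : ∀ p .{{_ : NonZero p}} r n → n ℤ.≤ ℤ.- (+ r) → F p r n ≡ 0ℤ
F-vanishes-below-pole p r n n≤-r = begin
  CdivT (r ℕ.* p) (n ℤ.* + p) ℤ.- CdivT r n
    ≡⟨ cong₂ ℤ._-_ (Λ-shiftLaur p r (CdivU (r ℕ.* p)) n) (shiftLaur-fromPS r (CdivU r) n) ⟩
  fromPS (CdivU (r ℕ.* p)) (s ℤ.* + p) ℤ.- fromPS (CdivU r) s
    ≡⟨ cong (ℤ._- fromPS (CdivU r) s) (fromPS-*-nonpos p (CdivU (r ℕ.* p)) s s≤0) ⟩
  fromPS (CdivU (r ℕ.* p)) s ℤ.- fromPS (CdivU r) s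
    ≡⟨ cong (ℤ._- fromPS (CdivU r) s) (fromPS-nonpos-head (CdivU (r ℕ.* p)) (CdivU r) s heads s≤0) ⟩
  fromPS (CdivU r) s ℤ.- fromPS (CdivU r) s
    ≡⟨ ℤ.+-inverseʳ (fromPS (CdivU r) s) ⟩
  0ℤ ∎
  where
  s : ℤ
  s = n ℤ.+ + r

  s≤0 : s ℤ.≤ 0ℤ
  s≤0 = ℤ.≤-trans (ℤ.+-monoˡ-≤ (+ r) n≤-r) (ℤ.≤-reflexive (ℤ.+-inverseˡ (+ r)))

  heads : CdivU (r ℕ.* p) 0 ≡ CdivU r 0
  heads = trans (CdivU-head (r ℕ.* p)) (sym (CdivU-head r))

proposition6p3 : (p : ℕ) → Prime p → 5 ≤ p → (r : ℕ) → 1 ≤ r → r ≤ 3 →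
    (n : ℤ) → n ℤ.≤ ℤ.- (+ r) → F p r n ≡ 0ℤ
proposition6p3 p@(suc _) _ _ r _ _ = F-vanishes-below-pole p r
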